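{- For every $n$ and every integer $D\in[1,n-1]$, any $D$-preserving distance labeling scheme for the family $\mathcal G_n$ of unweighted undirected graphs on $n$ nodes has maximum label size $\Omega(n/D)$ (with the constant in $\Omega$ independent of $n$ and $D$).
   Context: $dist_G(u,v)$ is the shortest-path distance. A labeling scheme for a family $\mathcal G$ consists of an encoder assigning to each node $u$ of each $G\in\mathcal G$ a bit string (label) $e_G(u)$, and a decoder $d$ that receives only two labels. It is a $D$-preserving distance labeling scheme if for all $G\in\mathcal G$ and $u,v\in V(G)$: (1) $d(e_G(u),e_G(v))\ge dist_G(u,v)$, and (2) $d(e_G(u),e_G(v))=dist_G(u,v)$ whenever $dist_G(u,v)\ge D$. The maximum label size is the maximum of $|e_G(u)|$ over all $G\in\mathcal G$ and $u\in V(G)$. -}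

module Defs where

open import Data.Nat using (ℕ; zero; suc; _+_; _*_; _≤_; _<_)
open import Data.Fin using (Fin)
open import Data.Bool using (Bool; true; false)
open import Data.List using (List; length)
open import Data.Maybe using (Maybe; just; nothing)
open import Data.Product using (Σ; ∃; _×_; _,_)
open import Data.Unit using (⊤)
open import Data.Empty using (⊥)
open import Relation.Binary.PropositionalEquality using (_≡_)
open import Relation.Nullary using (¬_)

record Graph (n : ℕ) : Set where
  field
    adj   : Fin n → Fin n → Bool
    sym   : ∀ u v → adj u v ≡ adj v u
    irrefl : ∀ u → adj u u ≡ false
open Graph public

data Walk {n : ℕ} (G : Graph n) : Fin n → Fin n → ℕ → Set where
  here : ∀ {u} → Walk G u u zero
  step : ∀ {u w v k} → adj G u w ≡ true → Walk G w v k → Walk G u v (suc k)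

DistLe : ∀ {n} → Graph n → Fin n → Fin n → ℕ → Set
DistLe G u v k = ∃ λ m → m ≤ k × Walk G u v m

-- ℕ∞ = Maybe ℕ, with nothing = ∞ (disconnected pair).
ℕ∞ : Set
ℕ∞ = Maybe ℕ

IsDist : ∀ {n} → Graph n → Fin n → Fin n → ℕ∞ → Set
IsDist G u v (just k) = DistLe G u v k × (∀ j → j < k → ¬ DistLe G u v j)
IsDist G u v nothing  = ∀ k → ¬ DistLe G u v k

_≥∞_ : ℕ∞ → ℕ∞ → Set
nothing ≥∞ _       = ⊤
just a  ≥∞ nothing = ⊥
just a  ≥∞ just b  = b ≤ a

Label : Set
Label = List Bool

record Scheme (n : ℕ) : Set where
  field
    encode : Graph n → Fin n → Label
    decode : Label → Label → ℕ∞
open Scheme public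

DPreserving : ∀ {n} → ℕ → Scheme n → Set
DPreserving {n} D S =
  (G : Graph n) (u v : Fin n) (δ : ℕ∞) → IsDist G u v δ →
    let r = decode S (encode S G u) (encode S G v) in
    (r ≥∞ δ) × (δ ≥∞ just D → r ≡ δ)

module Submission where

-- Let L = ⌊n / 11D⌋ + 1 and k = 2L + 1. For a k × k Boolean matrix H take k paths of D − 1 edges
-- whose feet are joined to bottom node j exactly when H i j, and a hub joined to all feet and
-- bottoms: the top of path i is at distance D or D + 1 from bottom j according to H i j. Both
-- distances are at least D, so the decoder recovers all k² bits of H from the 2k labels of tops
-- and bottoms; if every label had fewer than L bits there would be at most 2^(2kL) < 2^(k²) label
-- tuples. The kD + k + 1 nodes fit into n once L ≥ 2. When n < 11D a non-empty label suffices,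
-- and comparing a path of length D with the edgeless graph forces one.

open import Defs hiding (sym)
open import Data.Nat using (ℕ; zero; suc; _+_; _*_; _∸_; _^_; _≤_; _<_; z≤n; s≤s; NonZero)
open import Data.Nat.DivMod
open import Data.Nat.Tactic.RingSolver using (solve-∀)
open import Data.Nat.Properties
open import Data.Bool using (Bool; true; false; _∧_; _∨_; if_then_else_)
open import Data.Bool.Properties using (∨-comm)
open import Data.Fin using (Fin; toℕ; fromℕ<; combine; splitAt; _↑ˡ_; _↑ʳ_; funToFin; finToFun)
  renaming (zero to fzero; suc to fsuc)
open import Data.Fin.Properties
  using (2↔Bool; any?; injective⇒≤; toℕ<n; toℕ-fromℕ<; toℕ-combine; combine-surjective; splitAt-↑ˡ; splitAt-↑ʳ;
         finToFun-funToFin; funToFin-finToFin)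
open import Data.List using (List; []; _∷_; length)
open import Data.Product using (Σ; ∃; ∃₂; _×_; _,_; proj₁; proj₂)
open import Data.Maybe using (just; nothing)
open import Data.Maybe.Properties using (just-injective)
open import Data.Sum using ([_,_]′)
open import Data.Unit using (tt)
open import Function using (_∘_; Inverse; Injection; Injective)
open import Function.Properties.Inverse using (↔⇒↣; ↔-sym)
open import Relation.Binary.PropositionalEquality
open import Relation.Nullary using (yes; no; contradiction)
open import Relation.Nullary.Decidable using (⌊_⌋)

_++ʷ_ : ∀ {n} {G : Graph n} {u w v a b} → Walk G u w a → Walk G w v b → Walk G u v (a + b)
here       ++ʷ q = q
step e p ++ʷ q = step e (p ++ʷ q)

walk-potential-bound : ∀ {n} {G : Graph n} (φ : Fin n → ℕ) → (∀ {u v} → adj G u v ≡ true → φ u ≤ suc (φ v)) →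
                       ∀ {u v m} → Walk G u v m → φ u ≤ m + φ v
walk-potential-bound φ lip here       = ≤-refl
walk-potential-bound φ lip (step e p) = ≤-trans (lip e) (s≤s (walk-potential-bound φ lip p))

isDist-just : ∀ {n} {G : Graph n} {u v δ} → Walk G u v δ → (∀ {m} → Walk G u v m → δ ≤ m) →
              IsDist G u v (just δ)
isDist-just p minimal = (_ , ≤-refl , p) , λ { j j<δ (m , m≤j , q) → <⇒≱ j<δ (≤-trans (minimal q) m≤j) }

edgeless : ∀ n → Graph n
edgeless n = record { adj = λ _ _ → false ; sym = λ _ _ → refl ; irrefl = λ _ → refl }

isDist-edgeless : ∀ {n} {u v : Fin n} → u ≢ v → IsDist (edgeless n) u v nothing
isDist-edgeless u≢v _ (_ , _ , here) = u≢v refl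

module ArcGraph {K : Set} (arc : K → K → Bool) (arc-irrefl : ∀ x → arc x x ≡ false) {n} (κ : Fin n → K) where

  graph : Graph n
  graph = record
    { adj    = λ u v → arc (κ u) (κ v) ∨ arc (κ v) (κ u)
    ; sym    = λ u v → ∨-comm (arc (κ u) (κ v)) _
    ; irrefl = λ u → cong₂ _∨_ (arc-irrefl (κ u)) (arc-irrefl (κ u))
    }

  arc⇒adj : ∀ {u v} → arc (κ u) (κ v) ≡ true → adj graph u v ≡ true
  arc⇒adj uv rewrite uv = refl

  adj-potential : (φ : K → ℕ) → (∀ x y → arc x y ≡ true → φ x ≤ suc (φ y) × φ y ≤ suc (φ x)) →
                  ∀ {u v} → adj graph u v ≡ true → φ (κ u) ≤ suc (φ (κ v))
  adj-potential φ lip {u} {v} uv with arc (κ u) (κ v) in forward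
  ... | true  = proj₁ (lip (κ u) (κ v) forward)
  ... | false = proj₂ (lip (κ v) (κ u) uv)

l+i*n/n≡i : ∀ {l} i n .{{_ : NonZero n}} → l < n → (l + i * n) / n ≡ i
l+i*n/n≡i {l} i n l<n = begin
  (l + i * n) / n    ≡⟨ +-distrib-/ l (i * n) digits<n ⟩
  l / n + i * n / n  ≡⟨ cong₂ _+_ (m<n⇒m/n≡0 l<n) (m*n/n≡m i n) ⟩
  i                  ∎
  where
  open ≡-Reasoning
  digits<n : l % n + i * n % n < n
  digits<n = subst (_< n) (sym (trans (cong₂ _+_ (m<n⇒m%n≡m l<n) (m*n%n≡0 i n)) (+-identityʳ l))) l<n

l+i*n%n≡l : ∀ {l} i n .{{_ : NonZero n}} → l < n → (l + i * n) % n ≡ l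
l+i*n%n≡l {l} i n l<n = trans ([m+kn]%n≡m%n l i n) (m<n⇒m%n≡m l<n)

data Kind : Set where
  path   : ℕ → ℕ → Kind
  bottom : ℕ → Kind
  hub    : Kind
  idle   : Kind

lastLeg : Bool → ℕ
lastLeg true  = 1
lastLeg false = 2

lastLeg-injective : ∀ {a b} → lastLeg a ≡ lastLeg b → a ≡ b
lastLeg-injective {true}  {true}  _ = refl
lastLeg-injective {false} {false} _ = refl

lastLeg≤2 : ∀ b → lastLeg b ≤ 2
lastLeg≤2 true  = s≤s z≤n
lastLeg≤2 false = ≤-refl

d<d+lastLeg : ∀ d b → d < d + lastLeg b
d<d+lastLeg d true  = m<m+n d (s≤s z≤n)
d<d+lastLeg d false = m<m+n d (s≤s z≤n)

-- Path i runs through path i d, …, path i 0 (its top and its foot); the foot is adjacent to the hub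
-- and, exactly when H i j, to bottom j; the hub is adjacent to every bottom. Hence the distance from
-- the top of path i to bottom j is d + lastLeg (H i j).
module Gadget (d k : ℕ) (H : ℕ → ℕ → Bool) (n : ℕ) (room : k * suc d + k ≤ n) where

  arc : Kind → Kind → Bool
  arc (path i (suc l)) (path i′ l′) = ⌊ l ≟ l′ ⌋ ∧ ⌊ i ≟ i′ ⌋
  arc (path i zero)    (bottom j)   = H i j
  arc (path i zero)    hub          = true
  arc hub              (bottom j)   = true
  arc _                _            = false

  arc-irrefl : ∀ x → arc x x ≡ false
  arc-irrefl (path i zero)    = refl
  arc-irrefl (path i (suc l)) with l ≟ suc l
  ... | yes l≡1+l = contradiction (sym l≡1+l) 1+n≢n
  ... | no _      = refl
  arc-irrefl (bottom j)       = refl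
  arc-irrefl hub              = refl
  arc-irrefl idle             = refl

  arc-path : ∀ i l → arc (path i (suc l)) (path i l) ≡ true
  arc-path i l rewrite ≟-diag {l} refl | ≟-diag {i} refl = refl

  -- A lower bound on the distance to bottom j, attained at the tops.
  potential : ℕ → Kind → ℕ
  potential j (path i l)  = l + lastLeg (H i j)
  potential j (bottom j′) = if ⌊ j′ ≟ j ⌋ then 0 else 1
  potential j hub         = 1
  potential j idle        = 0

  potential-bottom : ∀ j → potential j (bottom j) ≡ 0
  potential-bottom j rewrite ≟-diag {j} refl = refl

  potential-bottom≤1 : ∀ j j′ → potential j (bottom j′) ≤ 1
  potential-bottom≤1 j j′ with j′ ≟ j
  ... | yes _ = z≤n
  ... | no  _ = ≤-refl

  arc-potential : ∀ j x y → arc x y ≡ true →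
                  potential j x ≤ suc (potential j y) × potential j y ≤ suc (potential j x)
  arc-potential j (path i (suc l)) (path i′ l′) e with l ≟ l′ | i ≟ i′
  ... | yes refl | yes refl = ≤-refl , m≤n⇒m≤1+n (n≤1+n _)
  arc-potential j (path i zero) (bottom j′) e with j′ ≟ j
  ... | yes refl rewrite e = ≤-refl , z≤n
  ... | no  _              = lastLeg≤2 (H i j) , s≤s z≤n
  arc-potential j (path i zero) hub         e = lastLeg≤2 (H i j) , s≤s z≤n
  arc-potential j hub           (bottom j′) e = s≤s z≤n , m≤n⇒m≤1+n (potential-bottom≤1 j j′)

  pathNodes : ℕ
  pathNodes = k * suc d

  beyondPaths : ℕ → Kind
  beyondPaths y with y <? k | y ≟ k
  ... | yes _ | _     = bottom y
  ... | no _  | yes _ = hub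
  ... | no _  | no _  = idle

  -- Node l + i * suc d is path i l; the paths are followed by the k bottoms, the hub and idle nodes.
  kindOf : ℕ → Kind
  kindOf x with x <? pathNodes
  ... | yes _ = path (x / suc d) (x % suc d)
  ... | no  _ = beyondPaths (x ∸ pathNodes)

  pathNode< : ∀ {i l} → i < k → l ≤ d → l + i * suc d < pathNodes
  pathNode< {i} {l} i<k l≤d = ≤-trans (+-monoˡ-≤ (i * suc d) (s≤s l≤d)) (*-monoˡ-≤ (suc d) i<k)

  kindOf-path : ∀ {i l} → i < k → l ≤ d → kindOf (l + i * suc d) ≡ path i l
  kindOf-path {i} {l} i<k l≤d with l + i * suc d <? pathNodes
  ... | yes _ = cong₂ path (l+i*n/n≡i i (suc d) (s≤s l≤d)) (l+i*n%n≡l i (suc d) (s≤s l≤d))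
  ... | no  ¬lt = contradiction (pathNode< i<k l≤d) ¬lt

  kindOf-beyond : ∀ y → kindOf (pathNodes + y) ≡ beyondPaths y
  kindOf-beyond y with pathNodes + y <? pathNodes
  ... | yes lt = contradiction lt (m+n≮m pathNodes y)
  ... | no  _  = cong beyondPaths (m+n∸m≡n pathNodes y)

  kindOf-bottom : ∀ {j} → j < k → kindOf (pathNodes + j) ≡ bottom j
  kindOf-bottom {j} j<k rewrite kindOf-beyond j with j <? k
  ... | yes _   = refl
  ... | no ¬j<k = contradiction j<k ¬j<k

  kindOf-hub : kindOf (pathNodes + k) ≡ hub
  kindOf-hub rewrite kindOf-beyond k | ≟-diag {k} refl with k <? k
  ... | yes k<k = contradiction k<k (n≮n k)
  ... | no  _   = refl

  open ArcGraph arc arc-irrefl {n} (kindOf ∘ toℕ) public using (graph)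
  open ArcGraph arc arc-irrefl {n} (kindOf ∘ toℕ) using (arc⇒adj; adj-potential)

  pathNodes≤n : pathNodes ≤ n
  pathNodes≤n = ≤-trans (m≤m+n pathNodes k) room

  pathVertex : Fin k → (l : ℕ) → .(l ≤ d) → Fin n
  pathVertex i l l≤d = fromℕ< (<-≤-trans (pathNode< (toℕ<n i) l≤d) pathNodes≤n)

  top foot bottomVertex : Fin k → Fin n
  top i          = pathVertex i d ≤-refl
  foot i         = pathVertex i 0 z≤n
  bottomVertex j = fromℕ< (<-≤-trans (+-monoʳ-< pathNodes (toℕ<n j)) room)

  hubVertex : pathNodes + k < n → Fin n
  hubVertex hubRoom = fromℕ< hubRoom

  kind-pathVertex : ∀ i l (l≤d : l ≤ d) → kindOf (toℕ (pathVertex i l l≤d)) ≡ path (toℕ i) l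
  kind-pathVertex i l l≤d = trans (cong kindOf (toℕ-fromℕ< _)) (kindOf-path (toℕ<n i) l≤d)

  kind-bottomVertex : ∀ j → kindOf (toℕ (bottomVertex j)) ≡ bottom (toℕ j)
  kind-bottomVertex j = trans (cong kindOf (toℕ-fromℕ< _)) (kindOf-bottom (toℕ<n j))

  kind-hubVertex : ∀ hubRoom → kindOf (toℕ (hubVertex hubRoom)) ≡ hub
  kind-hubVertex hubRoom = trans (cong kindOf (toℕ-fromℕ< hubRoom)) kindOf-hub

  link : ∀ {u v a b} → kindOf (toℕ u) ≡ a → kindOf (toℕ v) ≡ b → arc a b ≡ true → adj graph u v ≡ true
  link refl refl = arc⇒adj

  descend : ∀ i l (l≤d : l ≤ d) → Walk graph (pathVertex i l l≤d) (foot i) l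
  descend i zero    _     = here
  descend i (suc l) 1+l≤d =
    step (link (kind-pathVertex i (suc l) 1+l≤d) (kind-pathVertex i l l≤d) (arc-path (toℕ i) l))
         (descend i l l≤d)
    where l≤d = <⇒≤ 1+l≤d

  walk-direct : ∀ i j → H (toℕ i) (toℕ j) ≡ true → Walk graph (top i) (bottomVertex j) (d + 1)
  walk-direct i j e = descend i d ≤-refl ++ʷ step (link (kind-pathVertex i 0 z≤n) (kind-bottomVertex j) e) here

  walk-via-hub : ∀ hubRoom i j → Walk graph (top i) (bottomVertex j) (d + 2)
  walk-via-hub hubRoom i j = descend i d ≤-refl ++ʷ
    step (link (kind-pathVertex i 0 z≤n) (kind-hubVertex hubRoom) refl)
         (step (link (kind-hubVertex hubRoom) (kind-bottomVertex j) refl) here)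

  walk-length≥ : ∀ i j {m} → Walk graph (top i) (bottomVertex j) m → d + lastLeg (H (toℕ i) (toℕ j)) ≤ m
  walk-length≥ i j {m} w = begin
    d + lastLeg (H (toℕ i) (toℕ j))        ≡⟨ cong φ (kind-pathVertex i d ≤-refl) ⟨
    φ (kindOf (toℕ (top i)))               ≤⟨ walk-potential-bound (φ ∘ kindOf ∘ toℕ) φ-lipschitz w ⟩
    m + φ (kindOf (toℕ (bottomVertex j)))  ≡⟨ cong (λ x → m + φ x) (kind-bottomVertex j) ⟩
    m + φ (bottom (toℕ j))                 ≡⟨ cong (m +_) (potential-bottom (toℕ j)) ⟩
    m + 0                                  ≡⟨ +-identityʳ m ⟩
    m                                      ∎
    where
    open ≤-Reasoning
    φ = potential (toℕ j)
    φ-lipschitz = adj-potential φ (arc-potential (toℕ j))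

  distance : pathNodes + k < n → ∀ i j →
             IsDist graph (top i) (bottomVertex j) (just (d + lastLeg (H (toℕ i) (toℕ j))))
  distance hubRoom i j = isDist-just shortest (walk-length≥ i j)
    where
    shortest : Walk graph (top i) (bottomVertex j) (d + lastLeg (H (toℕ i) (toℕ j)))
    shortest with H (toℕ i) (toℕ j) in e
    ... | true  = walk-direct i j e
    ... | false = walk-via-hub hubRoom i j

  top≢bottom : ∀ i j → top i ≢ bottomVertex j
  top≢bottom i j eq = <⇒≢ top<bottom (cong toℕ eq)
    where
    top<bottom : toℕ (top i) < toℕ (bottomVertex j)
    top<bottom = subst₂ _<_ (sym (toℕ-fromℕ< _)) (sym (toℕ-fromℕ< _))
                   (<-≤-trans (pathNode< (toℕ<n i) ≤-refl) (m≤m+n pathNodes (toℕ j)))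

open Inverse 2↔Bool using () renaming (to to toBool; from to fromBool)

toBool-injective : Injective _≡_ _≡_ toBool
toBool-injective = Injection.injective (↔⇒↣ 2↔Bool)

fromBool-injective : Injective _≡_ _≡_ fromBool
fromBool-injective = Injection.injective (↔⇒↣ (↔-sym 2↔Bool))

funToFin-cong : ∀ {m n} {f g : Fin m → Fin n} → f ≗ g → funToFin f ≡ funToFin g
funToFin-cong {zero}  f≗g = refl
funToFin-cong {suc m} f≗g = cong₂ combine (f≗g fzero) (funToFin-cong (f≗g ∘ fsuc))

funToFin-injective : ∀ {m n} {f g : Fin m → Fin n} → funToFin f ≡ funToFin g → f ≗ g
funToFin-injective {f = f} {g} eq i =
  trans (sym (finToFun-funToFin f i)) (trans (cong (λ x → finToFun x i) eq) (finToFun-funToFin g i))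

finToFun-injective : ∀ {m n} {x y : Fin (m ^ n)} → finToFun {m} {n} x ≗ finToFun y → x ≡ y
finToFun-injective {m} {n} {x} {y} x≗y =
  trans (sym (funToFin-finToFin {n} {m} x)) (trans (funToFin-cong x≗y) (funToFin-finToFin {n} {m} y))

-- ℓ, then a 1 marking its end, then 0s: injective on strings of length < L.
pad : List Bool → (L : ℕ) → Fin L → Fin 2
pad []      (suc L) fzero    = fsuc fzero
pad []      (suc L) (fsuc i) = fzero
pad (b ∷ ℓ) (suc L) fzero    = fromBool b
pad (b ∷ ℓ) (suc L) (fsuc i) = pad ℓ L i

pad-marker : ∀ ℓ {L} (ℓ<L : length ℓ < L) → pad ℓ L (fromℕ< ℓ<L) ≡ fsuc fzero
pad-marker []      {suc L} _           = refl
pad-marker (b ∷ ℓ) {suc L} (s≤s ℓ<L) = pad-marker ℓ ℓ<L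

pad-injective : ∀ {ℓ ℓ′ L} → length ℓ < L → length ℓ′ < L → pad ℓ L ≗ pad ℓ′ L → ℓ ≡ ℓ′
pad-injective {[]}    {[]}      _           _            _  = refl
pad-injective {[]}    {b ∷ ℓ′}  _           (s≤s ℓ′<L)   eq
  with () ← trans (eq (fsuc (fromℕ< ℓ′<L))) (pad-marker ℓ′ ℓ′<L)
pad-injective {b ∷ ℓ} {[]}      (s≤s ℓ<L)   _            eq
  with () ← trans (sym (eq (fsuc (fromℕ< ℓ<L)))) (pad-marker ℓ ℓ<L)
pad-injective {b ∷ ℓ} {b′ ∷ ℓ′} (s≤s ℓ<L)   (s≤s ℓ′<L)   eq =
  cong₂ _∷_ (fromBool-injective (eq fzero)) (pad-injective ℓ<L ℓ′<L (eq ∘ fsuc))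

module _ {m p L : ℕ} (code : (Fin m → Bool) → Fin p → List Bool)
         (code-determines : ∀ F F′ → (∀ t → code F t ≡ code F′ t) → F ≗ F′) where

  private
    table : Fin (2 ^ m) → Fin m → Bool
    table x = toBool ∘ finToFun x

  ∃-long-codeword : p * L < m → ∃₂ λ F t → L ≤ length (code F t)
  ∃-long-codeword pL<m with any? (λ x → any? (λ t → L ≤? length (code (table x) t)))
  ... | yes (x , t , long) = table x , t , long
  ... | no noLong = contradiction 2^m≤2^Lp (<⇒≱ (^-monoʳ-< 2 (s≤s (s≤s z≤n)) Lp<m))
    where
    short : ∀ x t → length (code (table x) t) < L
    short x t = ≰⇒> (λ long → noLong (x , t , long))

    pack : Fin (2 ^ m) → Fin ((2 ^ L) ^ p)
    pack x = funToFin λ t → funToFin (pad (code (table x) t) L)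

    pack-injective : Injective _≡_ _≡_ pack
    pack-injective {x} {y} eq = finToFun-injective (toBool-injective ∘ code-determines _ _ sameCode)
      where
      sameCode : ∀ t → code (table x) t ≡ code (table y) t
      sameCode t = pad-injective (short x t) (short y t) (funToFin-injective (funToFin-injective eq t))

    2^m≤2^Lp : 2 ^ m ≤ 2 ^ (L * p)
    2^m≤2^Lp = subst (2 ^ m ≤_) (^-*-assoc 2 L p) (injective⇒≤ pack-injective)

    Lp<m : L * p < m
    Lp<m = subst (_< m) (*-comm p L) pL<m

lookupℕ : ∀ {m} → (Fin m → Bool) → ℕ → Bool
lookupℕ {zero}  F _       = false
lookupℕ {suc m} F zero    = F fzero
lookupℕ {suc m} F (suc x) = lookupℕ (F ∘ fsuc) x

lookupℕ-toℕ : ∀ {m} (F : Fin m → Bool) i → lookupℕ F (toℕ i) ≡ F i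
lookupℕ-toℕ F fzero    = refl
lookupℕ-toℕ F (fsuc i) = lookupℕ-toℕ (F ∘ fsuc) i

matrix : ∀ k → (Fin (k * k) → Bool) → ℕ → ℕ → Bool
matrix k F i j = lookupℕ F (k * i + j)

matrix-combine : ∀ k (F : Fin (k * k) → Bool) i j → matrix k F (toℕ i) (toℕ j) ≡ F (combine i j)
matrix-combine k F i j = trans (cong (lookupℕ F) (sym (toℕ-combine {k} {k} i j))) (lookupℕ-toℕ F (combine i j))

module _ {n D} (S : Scheme n) (DP : DPreserving D S) {G : Graph n} {u v : Fin n} where

  decode-exact : ∀ {δ} → IsDist G u v (just δ) → D ≤ δ → decode S (encode S G u) (encode S G v) ≡ just δ
  decode-exact dist = proj₂ (DP G u v _ dist)

  decode-disconnected : IsDist G u v nothing → decode S (encode S G u) (encode S G v) ≡ nothing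
  decode-disconnected dist = proj₂ (DP G u v _ dist) tt

cons-nonempty : ∀ {ℓ : List Bool} {b ℓ′} → ℓ ≡ b ∷ ℓ′ → 1 ≤ length ℓ
cons-nonempty refl = s≤s z≤n

distinct-decodings⇒nonempty-label :
  ∀ {n} (S : Scheme n) {G G′ : Graph n} {u v u′ v′ : Fin n} →
  decode S (encode S G u) (encode S G v) ≢ decode S (encode S G′ u′) (encode S G′ v′) →
  ∃₂ λ H w → 1 ≤ length (encode S H w)
distinct-decodings⇒nonempty-label S {G} {G′} {u} {v} {u′} {v′} differ
  with encode S G u in eu | encode S G v in ev | encode S G′ u′ in eu′ | encode S G′ v′ in ev′
... | _ ∷ _ | _     | _     | _     = G  , u  , cons-nonempty eu
... | []    | _ ∷ _ | _     | _     = G  , v  , cons-nonempty ev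
... | []    | []    | _ ∷ _ | _     = G′ , u′ , cons-nonempty eu′
... | []    | []    | []    | _ ∷ _ = G′ , v′ , cons-nonempty ev′
... | []    | []    | []    | []    = contradiction refl differ

module _ {n} (d : ℕ) (S : Scheme n) (DP : DPreserving (suc d) S) where

  ∃-nonempty-label : suc d + 1 ≤ n → ∃₂ λ G u → 1 ≤ length (encode S G u)
  ∃-nonempty-label d+2≤n = distinct-decodings⇒nonempty-label S differ
    where
    -- A single path ending at bottom 0: n may leave no room for the hub.
    open Gadget d 1 (λ _ _ → true) n (subst (λ x → x + 1 ≤ n) (sym (+-identityʳ (suc d))) d+2≤n)

    connected : IsDist graph (top fzero) (bottomVertex fzero) (just (d + 1))
    connected = isDist-just (walk-direct fzero fzero refl) (walk-length≥ fzero fzero)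

    differ : decode S (encode S graph (top fzero)) (encode S graph (bottomVertex fzero)) ≢
             decode S (encode S (edgeless n) (top fzero)) (encode S (edgeless n) (bottomVertex fzero))
    differ eq with () ← trans (sym (decode-exact S DP connected (d<d+lastLeg d true)))
                              (trans eq (decode-disconnected S DP (isDist-edgeless (top≢bottom fzero fzero))))

  ∃-label-of-length≥ : ∀ L → suc (L + L) * suc d + suc (L + L) < n → ∃₂ λ G u → L ≤ length (encode S G u)
  ∃-label-of-length≥ L hubRoom =
    let F , t , long = ∃-long-codeword code code-determines 2kL<k*k in _ , _ , long
    where
    k = suc (L + L)
    module Gad (F : Fin (k * k) → Bool) = Gadget d k (matrix k F) n (<⇒≤ hubRoom)

    code : (Fin (k * k) → Bool) → Fin (k + k) → List Bool
    code F t = encode S (Gad.graph F) ([ Gad.top F , Gad.bottomVertex F ]′ (splitAt k t))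

    decoded : ∀ F i j → decode S (code F (i ↑ˡ k)) (code F (k ↑ʳ j)) ≡
                        just (d + lastLeg (matrix k F (toℕ i) (toℕ j)))
    decoded F i j rewrite splitAt-↑ˡ k i k | splitAt-↑ʳ k k j =
      decode-exact S DP (Gad.distance F hubRoom i j) (d<d+lastLeg d _)

    code-determines : ∀ F F′ → (∀ t → code F t ≡ code F′ t) → F ≗ F′
    code-determines F F′ same q with i , j , refl ← combine-surjective {k} {k} q = begin
      F (combine i j)                ≡⟨ matrix-combine k F i j ⟨
      matrix k F (toℕ i) (toℕ j)     ≡⟨ lastLeg-injective (+-cancelˡ-≡ d _ _ (just-injective sameDecoded)) ⟩
      matrix k F′ (toℕ i) (toℕ j)    ≡⟨ matrix-combine k F′ i j ⟩
      F′ (combine i j)               ∎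
      where
      open ≡-Reasoning
      sameDecoded = trans (sym (decoded F i j))
                          (trans (cong₂ (decode S) (same (i ↑ˡ k)) (same (k ↑ʳ j))) (decoded F′ i j))

    2kL<k*k : (k + k) * L < k * k
    2kL<k*k = begin-strict
      (k + k) * L    ≡⟨ *-distribʳ-+ L k k ⟩
      k * L + k * L  ≡⟨ *-distribˡ-+ k L L ⟨
      k * (L + L)    <⟨ *-monoʳ-< k (n<1+n (L + L)) ⟩
      k * k          ∎
      where open ≤-Reasoning

1+n/m≤l⇒n≤m*l : ∀ n m {l} .{{_ : NonZero m}} → suc (n / m) ≤ l → n ≤ m * l
1+n/m≤l⇒n≤m*l n m {l} 1+n/m≤l = begin
  n                  ≡⟨ m≡m%n+[m/n]*n n m ⟩
  n % m + n / m * m  ≤⟨ +-monoˡ-≤ (n / m * m) (m%n≤n n m) ⟩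
  suc (n / m) * m    ≤⟨ *-monoˡ-≤ m 1+n/m≤l ⟩
  l * m              ≡⟨ *-comm l m ⟩
  m * l              ∎
  where open ≤-Reasoning

gadget-fits : ∀ q d → let k = suc (suc (suc q) + suc (suc q)) in k * suc d + k < suc q * (11 * suc d)
gadget-fits q d = ≤-trans (m≤m+n _ (9 * (q * d) + 7 * q + 6 * d)) (≤-reflexive (slack q d))
  where
  slack : ∀ q d → let k = suc (suc (suc q) + suc (suc q)) in
          suc (k * suc d + k) + (9 * (q * d) + 7 * q + 6 * d) ≡ suc q * (11 * suc d)
  slack = solve-∀

∃-label-length>n/11D : ∀ {n} d (S : Scheme n) → suc d + 1 ≤ n → DPreserving (suc d) S →
                       ∃₂ λ G u → suc (n / (11 * suc d)) ≤ length (encode S G u)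
∃-label-length>n/11D {n} d S d+2≤n DP with n / (11 * suc d) in n/m≡q
... | zero  = ∃-nonempty-label d S DP d+2≤n
... | suc q = ∃-label-of-length≥ d S DP (suc (suc q)) (<-≤-trans (gadget-fits q d) qm≤n)
  where
  qm≤n : suc q * (11 * suc d) ≤ n
  qm≤n = subst (λ x → x * (11 * suc d) ≤ n) n/m≡q (m/n*n≤m n (11 * suc d))

theorem4 : ∃ λ (c : ℕ) → 1 ≤ c ×
             ((n D : ℕ) → 1 ≤ D → D + 1 ≤ n → (S : Scheme n) → DPreserving D S →
               Σ (Graph n) λ G → Σ (Fin n) λ u → n ≤ c * D * length (encode S G u))
theorem4 = 11 , s≤s z≤n , bound
  where
  bound : (n D : ℕ) → 1 ≤ D → D + 1 ≤ n → (S : Scheme n) → DPreserving D S →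
          Σ (Graph n) λ G → Σ (Fin n) λ u → n ≤ 11 * D * length (encode S G u)
  bound n (suc d) _ d+2≤n S DP with G , u , long ← ∃-label-length>n/11D d S d+2≤n DP =
    G , u , 1+n/m≤l⇒n≤m*l n (11 * suc d) long
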